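{- Let $b\ge2$, $m\ge0$, $s\ge1$ and $u\ge0$ be integers and let $\mathbf{e}=(e_1,\dots,e_s)\in\mathbb{N}^s$. If a $(u,m,\mathbf{e},s)$-net in base $b$ is given, then for every integer $k$ with $u\le k\le m$ such that $m-k$ is a linear combination of $e_1,\dots,e_s$ with coefficients from $\mathbb{N}_0$, one can construct a $(u,k,\mathbf{e},s)$-net in base $b$.
   Context: $\mathbb{N}$ denotes the positive integers and $\mathbb{N}_0$ the nonnegative integers, $\lambda_s$ Lebesgue measure. An elementary interval in base $b$ is $J=\prod_{i=1}^s[a_ib^{ -d_i},(a_i+1)b^{ -d_i})$ with integers $d_i\ge0$, $0\le a_i<b^{d_i}$. For integers $0\le u\le m$ and $\mathbf{e}=(e_1,\dots,e_s)\in\mathbb{N}^s$, a point set (multiset) of $b^m$ points in $[0,1)^s$ is a $(u,m,\mathbf{e},s)$-net in base $b$ if every elementary interval $J$ in base $b$ with $\lambda_s(J)\ge b^{u-m}$ and $e_i\mid d_i$ for all $i$ contains exactly $b^m\lambda_s(J)$ of the points. -}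

module Defs where

open import Data.Nat using (ℕ; zero; suc; _+_; _*_; _∸_; _^_; _≤_; _<_; _≟_)
open import Data.Nat.Divisibility using (_∣_)
open import Data.Fin using (Fin; toℕ)
open import Data.Product using (Σ; _×_; ∃)
open import Relation.Nullary using (¬_; Dec; yes; no)
open import Relation.Binary.PropositionalEquality using (_≡_)

sumFin : (s : ℕ) → (Fin s → ℕ) → ℕ
sumFin zero f = 0
sumFin (suc s) f = f Fin.zero + sumFin s (λ i → f (Fin.suc i))

count : (n : ℕ) {P : Fin n → Set} → ((i : Fin n) → Dec (P i)) → ℕ
count zero P? = 0
count (suc n) P? with P? Fin.zero
... | yes _ = suc (count n (λ i → P? (Fin.suc i)))
... | no  _ = count n (λ i → P? (Fin.suc i))

-- A real number in [0,1) represented by its base-b digit expansion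
-- x = Σ_{j≥0} digit j * b^{-(j+1)}, with the standard normalisation
-- that the expansion does not end in an infinite tail of (b-1)'s.
-- (This is a bijection with [0,1).)
record UnitPt (b : ℕ) : Set where
  field
    digit   : ℕ → Fin b
    notTail : ∀ n → ∃ λ j → n ≤ j × ¬ (suc (toℕ (digit j)) ≡ b)
open UnitPt public

Point : (b s : ℕ) → Set
Point b s = Fin s → UnitPt b

-- ⌊ x * b^d ⌋ for x ∈ [0,1): the integer formed by the first d digits.
lead : {b : ℕ} → UnitPt b → ℕ → ℕ
lead {b} x zero = 0
lead {b} x (suc d) = lead x d * b + toℕ (digit x d)

-- x ∈ [a b^{-d}, (a+1) b^{-d})  iff  ⌊ x b^d ⌋ = a.
InInterval : {b : ℕ} → UnitPt b → (a d : ℕ) → Set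
InInterval x a d = lead x d ≡ a

-- An elementary interval in base b in dimension s:
-- J = Π_i [a_i b^{-d_i}, (a_i+1) b^{-d_i}) with 0 ≤ a_i < b^{d_i}.
record ElemInterval (b s : ℕ) : Set where
  field
    d   : Fin s → ℕ
    a   : Fin s → ℕ
    a<  : ∀ i → a i < b ^ d i
open ElemInterval public

_∈J_ : {b s : ℕ} → Point b s → ElemInterval b s → Set
_∈J_ {s = s} x J = ∀ (i : Fin s) → InInterval (x i) (a J i) (d J i)

private
  allFin? : (s : ℕ) {P : Fin s → Set} → ((i : Fin s) → Dec (P i)) → Dec (∀ i → P i)
  allFin? zero P? = yes (λ ())
  allFin? (suc s) P? with P? Fin.zero | allFin? s (λ i → P? (Fin.suc i))
  ... | yes p | yes ps = yes (λ { Fin.zero → p ; (Fin.suc i) → ps i })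
  ... | no ¬p | _ = no (λ f → ¬p (f Fin.zero))
  ... | yes _ | no ¬ps = no (λ f → ¬ps (λ i → f (Fin.suc i)))

_∈J?_ : {b s : ℕ} → (x : Point b s) → (J : ElemInterval b s) → Dec (x ∈J J)
_∈J?_ {s = s} x J = allFin? s (λ i → lead (x i) (d J i) ≟ a J i)

#in : {b s N : ℕ} → (Fin N → Point b s) → ElemInterval b s → ℕ
#in {N = N} P J = count N (λ n → P n ∈J? J)

-- (u,m,e,s)-net in base b: a multiset of b^m points such that every
-- elementary interval J with λ(J) = b^{-Σ d_i} ≥ b^{u-m} (i.e. Σ d_i ≤ m - u)
-- and e_i ∣ d_i for all i contains exactly b^m λ(J) = b^{m - Σ d_i} points.
IsNet : (b u m s : ℕ) (e : Fin s → ℕ) → (Fin (b ^ m) → Point b s) → Set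
IsNet b u m s e P =
  u ≤ m ×
  (∀ (J : ElemInterval b s) →
     sumFin s (d J) + u ≤ m →
     (∀ i → e i ∣ d J i) →
     #in P J ≡ b ^ (m ∸ sumFin s (d J)))

module Submission where

-- Let P be a (u,m,e,s)-net in base b and m - k = Σ c_i e_i.
-- Put w_i = c_i e_i and let C be the corner box Π_i [0, b^{-w_i}); its volume
-- is b^{k-m} ≥ b^{u-m} and e_i ∣ w_i, so C contains exactly b^k points of P.
-- Select these points and blow them up by the map x_i ↦ b^{w_i} x_i, which on
-- digit expansions drops the first w_i digits of coordinate i.  A point of C
-- lands in an elementary interval J iff it lies in the refined interval
-- Π_i [a_i b^{-(w_i+d_i)}, (a_i+1) b^{-(w_i+d_i)}) of P's unit cube, which is
-- again admissible for P; hence the rescaled points form a (u,k,e,s)-net.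

open import Defs
open import Data.Nat using (ℕ; _≤_; _∸_; _^_; _*_)
open import Data.Fin using (Fin)
open import Data.Product using (Σ; ∃; _×_)
open import Relation.Binary.PropositionalEquality using (_≡_)

open import Data.Nat using (zero; suc; _+_; _<_; NonZero)
open import Data.Nat.Properties
open import Data.Nat.Divisibility using (_∣_; ∣m∣n⇒∣m+n; n∣m*n)
open import Data.Fin using (toℕ)
open import Data.Product using (_,_; proj₂)
open import Relation.Nullary using (¬_; Dec; yes; no)
open import Relation.Nullary.Decidable using (_×-dec_)
open import Relation.Binary.PropositionalEquality using (refl; sym; trans; cong; subst; module ≡-Reasoning)
open import Data.Empty using (⊥-elim)
open import Data.Nat.Solver using (module +-*-Solver)

count-ext : (N : ℕ) {P P' : Fin N → Set} (P? : ∀ i → Dec (P i)) (P'? : ∀ i → Dec (P' i)) →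
  (∀ i → P i → P' i) → (∀ i → P' i → P i) → count N P? ≡ count N P'?
count-ext zero P? P'? to from = refl
count-ext (suc N) P? P'? to from with P? Fin.zero | P'? Fin.zero
... | yes p | yes p' = cong suc (count-ext N _ _ (λ i → to (Fin.suc i)) (λ i → from (Fin.suc i)))
... | yes p | no ¬p' = ⊥-elim (¬p' (to Fin.zero p))
... | no ¬p | yes p' = ⊥-elim (¬p (from Fin.zero p'))
... | no ¬p | no ¬p' = count-ext N _ _ (λ i → to (Fin.suc i)) (λ i → from (Fin.suc i))

select : (N : ℕ) {Pr : Fin N → Set} (Pr? : ∀ i → Dec (Pr i)) → Fin (count N Pr?) → Fin N
select (suc N) Pr? j with Pr? Fin.zero
select (suc N) Pr? Fin.zero    | yes _ = Fin.zero
select (suc N) Pr? (Fin.suc j) | yes _ = Fin.suc (select N (λ i → Pr? (Fin.suc i)) j)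
select (suc N) Pr? j           | no _  = Fin.suc (select N (λ i → Pr? (Fin.suc i)) j)

select-sound : (N : ℕ) {Pr : Fin N → Set} (Pr? : ∀ i → Dec (Pr i)) →
  ∀ j → Pr (select N Pr? j)
select-sound (suc N) Pr? j with Pr? Fin.zero
select-sound (suc N) Pr? Fin.zero    | yes p = p
select-sound (suc N) Pr? (Fin.suc j) | yes _ = select-sound N (λ i → Pr? (Fin.suc i)) j
select-sound (suc N) Pr? j           | no _  = select-sound N (λ i → Pr? (Fin.suc i)) j

select-count : (N : ℕ) {Pr : Fin N → Set} (Pr? : ∀ i → Dec (Pr i))
  {R : Fin N → Set} (R? : ∀ i → Dec (R i)) →
  count (count N Pr?) (λ j → R? (select N Pr? j)) ≡ count N (λ i → Pr? i ×-dec R? i)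
select-count zero Pr? R? = refl
select-count (suc N) Pr? R? with Pr? Fin.zero
... | no _ = select-count N (λ i → Pr? (Fin.suc i)) (λ i → R? (Fin.suc i))
... | yes _ with R? Fin.zero
...   | yes _ = cong suc (select-count N (λ i → Pr? (Fin.suc i)) (λ i → R? (Fin.suc i)))
...   | no _  = select-count N (λ i → Pr? (Fin.suc i)) (λ i → R? (Fin.suc i))

record Selection (N : ℕ) {Pr : Fin N → Set} (Pr? : ∀ i → Dec (Pr i)) (M : ℕ) : Set₁ where
  field
    index  : Fin M → Fin N
    sound  : ∀ j → Pr (index j)
    counts : ∀ {R : Fin N → Set} (R? : ∀ i → Dec (R i)) →
             count M (λ j → R? (index j)) ≡ count N (λ i → Pr? i ×-dec R? i)
open Selection

selection : (N : ℕ) {Pr : Fin N → Set} (Pr? : ∀ i → Dec (Pr i)) →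
  (M : ℕ) → count N Pr? ≡ M → Selection N Pr? M
selection N Pr? .(count N Pr?) refl = record
  { index = select N Pr? ; sound = select-sound N Pr? ; counts = select-count N Pr? }

sumFin-+ : (s : ℕ) (f g : Fin s → ℕ) → sumFin s (λ i → f i + g i) ≡ sumFin s f + sumFin s g
sumFin-+ zero f g = refl
sumFin-+ (suc s) f g rewrite sumFin-+ s (λ i → f (Fin.suc i)) (λ i → g (Fin.suc i)) =
  solve 4 (λ a b c d → (a :+ b) :+ (c :+ d) := (a :+ c) :+ (b :+ d)) refl
    (f Fin.zero) (g Fin.zero) (sumFin s (λ i → f (Fin.suc i))) (sumFin s (λ i → g (Fin.suc i)))
  where open +-*-Solver

-- b^c x mod 1: drop the first c digits.  A tail of the expansion is still
-- not eventually b-1, so this stays a point of [0,1).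
shift : ∀ {b} → ℕ → UnitPt b → UnitPt b
digit (shift c x) j = digit x (c + j)
notTail (shift {b} c x) n with notTail x (c + n)
... | j , c+n≤j , notLast = j ∸ c , n≤j∸c , notLast'
  where
  c≤j : c ≤ j
  c≤j = ≤-trans (m≤m+n c n) c+n≤j
  n≤j∸c : n ≤ j ∸ c
  n≤j∸c = subst (_≤ j ∸ c) (m+n∸m≡n c n) (∸-monoˡ-≤ c c+n≤j)
  notLast' : ¬ (suc (toℕ (digit x (c + (j ∸ c)))) ≡ b)
  notLast' rewrite m+[n∸m]≡n c≤j = notLast

lead-split : ∀ {b} (x : UnitPt b) c d → lead x (c + d) ≡ lead x c * b ^ d + lead (shift c x) d
lead-split x c zero rewrite +-identityʳ c = sym (trans (+-identityʳ _) (*-identityʳ (lead x c)))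
lead-split {b} x c (suc d) rewrite +-suc c d | lead-split x c d =
  solve 5 (λ l p t r β → (l :* p :+ t) :* β :+ r := l :* (β :* p) :+ (t :* β :+ r)) refl
    (lead x c) (b ^ d) (lead (shift c x) d) (toℕ (digit x (c + d))) b
  where open +-*-Solver

lead-prefix-zero : ∀ {b} (x : UnitPt b) c d → lead x (c + d) < b ^ d → lead x c ≡ 0
lead-prefix-zero {b} x c d small with lead x c | lead-split x c d
... | zero  | _     = refl
... | suc l | split = ⊥-elim (<-irrefl refl (≤-trans small bound))
  where
  bound : b ^ d ≤ lead x (c + d)
  bound = ≤-trans (m≤m+n (b ^ d) _) (≤-trans (m≤m+n _ _) (≤-reflexive (sym split)))

shiftPt : ∀ {b s} → (Fin s → ℕ) → Point b s → Point b s
shiftPt c x i = shift (c i) (x i)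

module _ {b s : ℕ} .{{_ : NonZero b}} where

  corner : (Fin s → ℕ) → ElemInterval b s
  corner c = record { d = c ; a = λ _ → 0 ; a< = λ i → m^n>0 b (c i) }

  -- The preimage of J ⊆ [0,1)^s inside the corner box c under rescaling:
  -- Π_i [a_i b^{-(c_i+d_i)}, (a_i+1) b^{-(c_i+d_i)}).
  refine : (Fin s → ℕ) → ElemInterval b s → ElemInterval b s
  refine c J = record
    { d = λ i → c i + d J i ; a = a J
    ; a< = λ i → <-≤-trans (a< J i) (^-monoʳ-≤ b (m≤n+m (d J i) (c i))) }

  refine⇒corner : ∀ c J (x : Point b s) → x ∈J refine c J → x ∈J corner c
  refine⇒corner c J x x∈ i = lead-prefix-zero (x i) (c i) (d J i) (subst (_< b ^ d J i) (sym (x∈ i)) (a< J i))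

  corner-lead : ∀ c (x : Point b s) → x ∈J corner c → ∀ i n →
    lead (x i) (c i + n) ≡ lead (shift (c i) (x i)) n
  corner-lead c x x∈C i n = begin
    lead (x i) (c i + n)                                 ≡⟨ lead-split (x i) (c i) n ⟩
    lead (x i) (c i) * b ^ n + lead (shift (c i) (x i)) n ≡⟨ cong (λ l → l * b ^ n + lead (shift (c i) (x i)) n) (x∈C i) ⟩
    lead (shift (c i) (x i)) n                           ∎
    where open ≡-Reasoning

  refine⇒shift : ∀ c J (x : Point b s) → x ∈J corner c → x ∈J refine c J → shiftPt c x ∈J J
  refine⇒shift c J x x∈C x∈ i = trans (sym (corner-lead c x x∈C i (d J i))) (x∈ i)

  shift⇒refine : ∀ c J (x : Point b s) → x ∈J corner c → shiftPt c x ∈J J → x ∈J refine c J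
  shift⇒refine c J x x∈C x∈ i = trans (corner-lead c x x∈C i (d J i)) (x∈ i)

  rescale-count : ∀ {N M} (P : Fin N → Point b s) (c : Fin s → ℕ)
    (S : Selection N (λ n → P n ∈J? corner c) M) (J : ElemInterval b s) →
    #in (λ j → shiftPt c (P (index S j))) J ≡ #in P (refine c J)
  rescale-count {N} {M} P c S J = begin
    #in (λ j → shiftPt c (P (index S j))) J
      ≡⟨ count-ext M _ _ (λ j → shift⇒refine c J (P (index S j)) (sound S j))
                         (λ j → refine⇒shift c J (P (index S j)) (sound S j)) ⟩
    count M (λ j → P (index S j) ∈J? refine c J)
      ≡⟨ counts S (λ n → P n ∈J? refine c J) ⟩
    count N (λ n → (P n ∈J? corner c) ×-dec (P n ∈J? refine c J))
      ≡⟨ count-ext N _ _ (λ n → proj₂) (λ n x∈ → refine⇒corner c J (P n) x∈ , x∈) ⟩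
    #in P (refine c J) ∎
    where open ≡-Reasoning

net-count : ∀ {b u m s e} {P : Fin (b ^ m) → Point b s} → IsNet b u m s e P →
  ∀ {k} → k ≤ m → (J : ElemInterval b s) → (∀ i → e i ∣ d J i) →
  ∀ t → sumFin s (d J) ≡ (m ∸ k) + t → t + u ≤ k → #in P J ≡ b ^ (k ∸ t)
net-count {b} {u} {m} {P = P} (_ , net) {k} k≤m J e∣d t depth t+u≤k = begin
  #in P J                     ≡⟨ net J admissible e∣d ⟩
  b ^ (m ∸ sumFin _ (d J))    ≡⟨ cong (λ r → b ^ (m ∸ r)) depth ⟩
  b ^ (m ∸ ((m ∸ k) + t))     ≡⟨ cong (b ^_) (sym (∸-+-assoc m (m ∸ k) t)) ⟩
  b ^ ((m ∸ (m ∸ k)) ∸ t)     ≡⟨ cong (λ r → b ^ (r ∸ t)) (m∸[m∸n]≡n k≤m) ⟩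
  b ^ (k ∸ t)                 ∎
  where
  open ≡-Reasoning
  admissible : sumFin _ (d J) + u ≤ m
  admissible rewrite depth | +-assoc (m ∸ k) t u =
    ≤-trans (+-monoʳ-≤ (m ∸ k) t+u≤k) (≤-reflexive (m∸n+n≡m k≤m))

proposition3 : (b m s u : ℕ) → 2 ≤ b → 1 ≤ s →
    (e : Fin s → ℕ) → (∀ i → 1 ≤ e i) →
    (P : Fin (b ^ m) → Point b s) → IsNet b u m s e P →
    (k : ℕ) → u ≤ k → k ≤ m →
    (∃ λ (c : Fin s → ℕ) → m ∸ k ≡ sumFin s (λ i → c i * e i)) →
    Σ (Fin (b ^ k) → Point b s) (λ Q → IsNet b u k s e Q)
-- (Matching b as suc _ uses b ≥ 2 only to have b ≠ 0.)
proposition3 b@(suc _) m s u _ _ e _ P isNetP k u≤k k≤m (c , m∸k≡Σw) =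
  (λ j → shiftPt w (P (index S j))) , u≤k , isNet
  where
  w : Fin s → ℕ
  w i = c i * e i

  Σw≡m∸k : sumFin s w ≡ m ∸ k
  Σw≡m∸k = sym m∸k≡Σw

  -- The corner box has depth m - k and e-divisible sides: b^k points of P.
  S : Selection (b ^ m) (λ n → P n ∈J? corner w) (b ^ k)
  S = selection (b ^ m) (λ n → P n ∈J? corner w) (b ^ k)
        (net-count isNetP k≤m (corner w) (λ i → n∣m*n (c i)) 0 (trans Σw≡m∸k (sym (+-identityʳ (m ∸ k)))) u≤k)

  -- Rescaled points in J are the points of P in refine w J, of depth (m - k) + Σ d.
  isNet : (J : ElemInterval b s) → sumFin s (d J) + u ≤ k → (∀ i → e i ∣ d J i) →
          #in (λ j → shiftPt w (P (index S j))) J ≡ b ^ (k ∸ sumFin s (d J))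
  isNet J admissible e∣d = trans (rescale-count P w S J)
    (net-count isNetP k≤m (refine w J) (λ i → ∣m∣n⇒∣m+n (n∣m*n (c i)) (e∣d i))
      (sumFin s (d J)) (trans (sumFin-+ s w (d J)) (cong (_+ sumFin s (d J)) Σw≡m∸k)) admissible)
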